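{- Let $s(n)$ be the number of tournament sequences of length $n$. Then $$\log_2 s(n)=\binom{n}{2}-\log_2(n!)+O\big((\log n)^2\big)$$ as $n\to\infty$.
   Context: A tournament sequence of length $n$ is a sequence of positive integers $(t_1,\ldots,t_n)$ with $t_1=1$ and $t_i<t_{i+1}\leq 2t_i$ for $1\leq i<n$. -}

module Defs where

open import Data.Nat using (ℕ; zero; suc; _*_; _<ᵇ_; _≤ᵇ_; _≡ᵇ_)
open import Data.Bool using (Bool; true; false; _∧_; T)
open import Data.List using (List; []; _∷_)
open import Data.Vec using (Vec; toList)
open import Data.Product using (Σ)

chainOK : ℕ → List ℕ → Bool
chainOK x []       = true
chainOK x (y ∷ ys) = (x <ᵇ y) ∧ (y ≤ᵇ 2 * x) ∧ chainOK y ys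

-- (t₁,…,tₙ) is a tournament sequence: t₁ = 1 and tᵢ < tᵢ₊₁ ≤ 2tᵢ
-- (positivity follows from t₁ = 1 and strict increase).
isTournament : List ℕ → Bool
isTournament []       = true
isTournament (x ∷ xs) = (x ≡ᵇ 1) ∧ chainOK x xs

TournamentSeq : ℕ → Set
TournamentSeq n = Σ (Vec ℕ n) (λ t → T (isTournament (toList t)))

{-# OPTIONS --safe #-}
-- Dropping the leading 1, a tournament sequence of length r + 1 is a chain
-- 1 = t₁ < t₂ ≤ 2t₁, t₂ < t₃ ≤ 2t₂, … of r further terms, so s(r + 1) = chainCount r 1, where
-- chainCount (r + 1) x = Σ_{x < y ≤ 2x} chainCount r y.  Comparing these sums with ∫ y^d dy
-- (telescoped Bernoulli inequalities) gives, by induction on d,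
--   ∏_{j=1}^{d} (2^j − 1) · k^d  ≤  d! · chainCount d k  ≤  2^{C(d+1,2)} · (k + 1)^d.
-- At k = 1 the left bound together with ∏_{j≥1} (1 − 2^{−j}) ≥ 1/4 gives 2^{C(n,2)} ≤ 4 · s(n) · n!.
-- The right bound at k = 1 loses a factor 2^n.  Instead, the first i = ⌊log₂ n⌋ + 1 steps are
-- bounded crudely by (number of choices) × (largest term); the remaining d = n − 1 − i steps
-- start from a term at most 2^i > d, and (2^i + 1)^d ≤ 2^{i(d+1)}, C(i,2) + C(d+1,2) + i(d+1) = C(n,2).
-- What is lost is n!/d! ≤ n^{i+1} = 2^{O(log² n)}.
module Submission where

open import Defs
open import Data.Nat using (ℕ; _+_; _*_; _^_; _≤_; _!)
open import Data.Nat.Combinatorics using (_C_)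
open import Data.Nat.Logarithm using (⌊log₂_⌋)
open import Data.Fin using (Fin)
open import Data.Product using (_×_; ∃-syntax)
open import Function.Bundles using (_↔_)

open import Data.Bool using (T)
open import Data.Bool.Properties using (T-∧; T-irrelevant)
open import Data.Empty using (⊥-elim)
open import Data.Fin.Permutation using (↔⇒≡)
open import Data.Fin.Properties using (+↔⊎)
open import Data.Nat
open import Data.Nat.Combinatorics using (nCk+nC[k+1]≡[n+1]C[k+1]; nC1≡n)
open import Data.Nat.Logarithm using (⌊log₂⌋-mono-≤; ⌊log₂[2^n]⌋≡n)
open import Data.Nat.Properties
open import Data.Nat.Tactic.RingSolver using (solve-∀)
open import Data.Product using (Σ; _,_; proj₁; proj₂)
open import Data.Sum using (_⊎_; inj₁; inj₂)
open import Data.Sum.Function.Propositional using (_⊎-↔_)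
open import Data.Unit using (tt)
open import Data.Vec using (Vec; toList; []; _∷_)
open import Function using (_∘_)
open import Function.Bundles using (Equivalence; _⇔_; mk⇔; mk↔ₛ′)
open import Function.Construct.Composition using (_↔-∘_)
open import Function.Construct.Symmetry using (↔-sym)
open import Relation.Binary.PropositionalEquality
open import Relation.Nullary using (¬_; Dec; yes; no)

sumRange : ℕ → ℕ → (ℕ → ℕ) → ℕ
sumRange lo zero      f = 0
sumRange lo (suc len) f = f lo + sumRange (suc lo) len f

InRange : ℕ → ℕ → ℕ → Set
InRange lo len y = lo ≤ y × y < lo + len

InRange-irrelevant : ∀ {lo len y} (p q : InRange lo len y) → p ≡ q
InRange-irrelevant (a , b) (a′ , b′) = cong₂ _,_ (≤-irrelevant a a′) (<-irrelevant b b′)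

InRange-first : ∀ lo len → InRange lo (suc len) lo
InRange-first lo len = ≤-refl , subst (lo <_) (sym (+-suc lo len)) (s≤s (m≤m+n lo len))

InRange-shift : ∀ {lo len y} → InRange (suc lo) len y → InRange lo (suc len) y
InRange-shift {lo} {len} {y} (lo<y , y<) = <⇒≤ lo<y , subst (y <_) (sym (+-suc lo len)) y<

InRange-unshift : ∀ {lo len y} → InRange lo (suc len) y → y ≢ lo → InRange (suc lo) len y
InRange-unshift {lo} {len} {y} (lo≤y , y<) y≢lo =
  ≤∧≢⇒< lo≤y (y≢lo ∘ sym) , subst (y <_) (+-suc lo len) y<

sumRange-*ˡ : ∀ c lo len f → sumRange lo len (λ j → c * f j) ≡ c * sumRange lo len f
sumRange-*ˡ c lo zero      f = sym (*-zeroʳ c)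
sumRange-*ˡ c lo (suc len) f =
  trans (cong (c * f lo +_) (sumRange-*ˡ c (suc lo) len f)) (sym (*-distribˡ-+ c (f lo) _))

sumRange-mono-≤ : ∀ lo len {f g} → (∀ j → InRange lo len j → f j ≤ g j) →
                  sumRange lo len f ≤ sumRange lo len g
sumRange-mono-≤ lo zero      f≤g = ≤-refl
sumRange-mono-≤ lo (suc len) f≤g =
  +-mono-≤ (f≤g lo (InRange-first lo len)) (sumRange-mono-≤ (suc lo) len (λ j r → f≤g j (InRange-shift r)))

sumRange-≤-* : ∀ lo len {f} M → (∀ j → InRange lo len j → f j ≤ M) → sumRange lo len f ≤ len * M
sumRange-≤-* lo zero      M f≤M = ≤-refl
sumRange-≤-* lo (suc len) M f≤M =
  +-mono-≤ (f≤M lo (InRange-first lo len)) (sumRange-≤-* (suc lo) len M (λ j r → f≤M j (InRange-shift r)))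

RangeΣ : (ℕ → Set) → ℕ → ℕ → Set
RangeΣ F lo len = Σ ℕ λ y → InRange lo len y × F y

module _ (F : ℕ → Set) (lo len : ℕ) where

  private
    split : ∀ y → InRange lo (suc len) y → F y → Dec (y ≡ lo) → F lo ⊎ RangeΣ F (suc lo) len
    split y r c (yes refl) = inj₁ c
    split y r c (no y≢lo)  = inj₂ (y , InRange-unshift r y≢lo , c)

    join : F lo ⊎ RangeΣ F (suc lo) len → RangeΣ F lo (suc len)
    join (inj₁ c)           = lo , InRange-first lo len , c
    join (inj₂ (y , r , c)) = y , InRange-shift r , c

    join-split : ∀ y r c d → join (split y r c d) ≡ (y , r , c)
    join-split y r c (yes refl) = cong (λ r′ → lo , r′ , c) (InRange-irrelevant _ _)
    join-split y r c (no _)     = cong (λ r′ → y , r′ , c) (InRange-irrelevant _ _)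

    split-lo : ∀ r c d → split lo r c d ≡ inj₁ c
    split-lo r c (yes refl) = refl
    split-lo r c (no lo≢lo) = ⊥-elim (lo≢lo refl)

    split-above : ∀ y r r′ c d → lo < y → split y r c d ≡ inj₂ (y , r′ , c)
    split-above y r r′ c (yes refl) lo<lo = ⊥-elim (n≮n lo lo<lo)
    split-above y r r′ c (no _)     _     = cong (λ r″ → inj₂ (y , r″ , c)) (InRange-irrelevant _ _)

    unjoin : RangeΣ F lo (suc len) → F lo ⊎ RangeΣ F (suc lo) len
    unjoin (y , r , c) = split y r c (y ≟ lo)

    unjoin-join : ∀ z → unjoin (join z) ≡ z
    unjoin-join (inj₁ c)           = split-lo _ c _
    unjoin-join (inj₂ (y , r , c)) = split-above y _ r c _ (proj₁ r)

  RangeΣ-split : RangeΣ F lo (suc len) ↔ (F lo ⊎ RangeΣ F (suc lo) len)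
  RangeΣ-split = mk↔ₛ′ unjoin join unjoin-join (λ (y , r , c) → join-split y r c _)

RangeΣ↔Fin : (F : ℕ → Set) (f : ℕ → ℕ) → (∀ y → F y ↔ Fin (f y)) →
             ∀ lo len → RangeΣ F lo len ↔ Fin (sumRange lo len f)
RangeΣ↔Fin F f F↔f lo zero = mk↔ₛ′ (λ (_ , r , _) → ⊥-elim (empty r)) (λ ()) (λ ()) (λ (_ , r , _) → ⊥-elim (empty r))
  where
  empty : ∀ {y} → ¬ InRange lo 0 y
  empty (lo≤y , y<lo+0) = <⇒≱ (subst (_ <_) (+-identityʳ lo) y<lo+0) lo≤y
RangeΣ↔Fin F f F↔f lo (suc len) =
  ↔-sym +↔⊎ ↔-∘ ((F↔f lo ⊎-↔ RangeΣ↔Fin F f F↔f (suc lo) len) ↔-∘ RangeΣ-split F lo len)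

Chain : ℕ → ℕ → Set
Chain r x = Σ (Vec ℕ r) (λ v → T (chainOK x (toList v)))

chainCount : ℕ → ℕ → ℕ
chainCount zero    x = 1
chainCount (suc r) x = sumRange (suc x) x (chainCount r)

2*m≡m+m : ∀ m → 2 * m ≡ m + m
2*m≡m+m m = cong (m +_) (+-identityʳ m)

T-chainOK-∷ : ∀ {x y n} {v : Vec ℕ n} →
              T (chainOK x (toList (y ∷ v))) ⇔ (InRange (suc x) x y × T (chainOK y (toList v)))
T-chainOK-∷ {x} {y} = mk⇔
  (λ p → let (x<y , q) = Equivalence.to T-∧ p ; (y≤2x , q′) = Equivalence.to T-∧ q in
         (<ᵇ⇒< x y x<y , s≤s (subst (y ≤_) (2*m≡m+m x) (≤ᵇ⇒≤ y (2 * x) y≤2x))) , q′)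
  (λ ((x<y , y<1+x+x) , q) →
         Equivalence.from T-∧ (<⇒<ᵇ x<y , Equivalence.from T-∧ (≤⇒≤ᵇ (subst (y ≤_) (sym (2*m≡m+m x)) (s≤s⁻¹ y<1+x+x)) , q)))

Chain-suc↔RangeΣ : ∀ r x → Chain (suc r) x ↔ RangeΣ (Chain r) (suc x) x
Chain-suc↔RangeΣ r x = mk↔ₛ′ to from to-from from-to
  where
  to : Chain (suc r) x → RangeΣ (Chain r) (suc x) x
  to (y ∷ v , p) = let (range , q) = Equivalence.to (T-chainOK-∷ {v = v}) p in y , range , v , q

  from : RangeΣ (Chain r) (suc x) x → Chain (suc r) x
  from (y , range , v , q) = y ∷ v , Equivalence.from (T-chainOK-∷ {v = v}) (range , q)

  to-from : ∀ z → to (from z) ≡ z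
  to-from (y , range , v , q) = cong₂ (λ range′ q′ → y , range′ , v , q′) (InRange-irrelevant _ _) (T-irrelevant _ _)

  from-to : ∀ c → from (to c) ≡ c
  from-to (y ∷ v , p) = cong (y ∷ v ,_) (T-irrelevant _ _)

Chain↔Fin : ∀ r x → Chain r x ↔ Fin (chainCount r x)
Chain↔Fin zero    x =
  mk↔ₛ′ (λ _ → Fin.zero) (λ _ → [] , tt) (λ { Fin.zero → refl ; (Fin.suc ()) }) (λ { ([] , tt) → refl })
Chain↔Fin (suc r) x = RangeΣ↔Fin (Chain r) (chainCount r) (Chain↔Fin r) (suc x) x ↔-∘ Chain-suc↔RangeΣ r x

TournamentSeq-suc↔Chain : ∀ r → TournamentSeq (suc r) ↔ Chain r 1
TournamentSeq-suc↔Chain r = mk↔ₛ′ to (λ (v , p) → 1 ∷ v , p) (λ _ → refl) from-to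
  where
  to : TournamentSeq (suc r) → Chain r 1
  to (1 ∷ v , p) = v , p
  to (0 ∷ v , ())
  to (suc (suc _) ∷ v , ())

  from-to : ∀ t → (1 ∷ proj₁ (to t) , proj₂ (to t)) ≡ t
  from-to (1 ∷ v , p) = refl
  from-to (0 ∷ v , ())
  from-to (suc (suc _) ∷ v , ())

tournamentCount : (s : ℕ → ℕ) → (∀ n → Fin (s n) ↔ TournamentSeq n) → ∀ r → s (suc r) ≡ chainCount r 1
tournamentCount s s↔ r = ↔⇒≡ (Chain↔Fin r 1 ↔-∘ (TournamentSeq-suc↔Chain r ↔-∘ s↔ (suc r)))

[1+n]C2≡nC2+n : ∀ n → suc n C 2 ≡ n C 2 + n
[1+n]C2≡nC2+n n = begin
  suc n C 2         ≡⟨ nCk+nC[k+1]≡[n+1]C[k+1] n 1 ⟨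
  n C 1 + n C 2     ≡⟨ cong (_+ n C 2) (nC1≡n n) ⟩
  n + n C 2         ≡⟨ +-comm n (n C 2) ⟩
  n C 2 + n         ∎
  where open ≡-Reasoning

[m+n]C2≡mC2+nC2+m*n : ∀ m n → (m + n) C 2 ≡ m C 2 + n C 2 + m * n
[m+n]C2≡mC2+nC2+m*n m zero = begin
  (m + 0) C 2              ≡⟨ cong (_C 2) (+-identityʳ m) ⟩
  m C 2                    ≡⟨ rearrange (m C 2) m ⟩
  m C 2 + 0 + m * 0        ∎
  where
  open ≡-Reasoning
  rearrange : ∀ c m → c ≡ c + 0 + m * 0
  rearrange = solve-∀
[m+n]C2≡mC2+nC2+m*n m (suc n) = begin
  (m + suc n) C 2                      ≡⟨ cong (_C 2) (+-suc m n) ⟩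
  suc (m + n) C 2                      ≡⟨ [1+n]C2≡nC2+n (m + n) ⟩
  (m + n) C 2 + (m + n)                ≡⟨ cong (_+ (m + n)) ([m+n]C2≡mC2+nC2+m*n m n) ⟩
  m C 2 + n C 2 + m * n + (m + n)      ≡⟨ rearrange (m C 2) (n C 2) m n ⟩
  m C 2 + (n C 2 + n) + m * suc n      ≡⟨ cong (λ k → m C 2 + k + m * suc n) ([1+n]C2≡nC2+n n) ⟨
  m C 2 + suc n C 2 + m * suc n        ∎
  where
  open ≡-Reasoning
  rearrange : ∀ a b m n → a + b + m * n + (m + n) ≡ a + (b + n) + m * suc n
  rearrange = solve-∀

2^[[2+n]C2]≡2^[[1+n]C2]*2^[1+n] : ∀ n → 2 ^ (suc (suc n) C 2) ≡ 2 ^ (suc n C 2) * 2 ^ suc n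
2^[[2+n]C2]≡2^[[1+n]C2]*2^[1+n] n =
  trans (cong (2 ^_) ([1+n]C2≡nC2+n (suc n))) (^-distribˡ-+-* 2 (suc n C 2) (suc n))

^-distrib-* : ∀ a b n → (a * b) ^ n ≡ a ^ n * b ^ n
^-distrib-* a b zero    = refl
^-distrib-* a b (suc n) = begin
  a * b * (a * b) ^ n        ≡⟨ cong (a * b *_) (^-distrib-* a b n) ⟩
  a * b * (a ^ n * b ^ n)    ≡⟨ interchange a b (a ^ n) (b ^ n) ⟩
  a * a ^ n * (b * b ^ n)    ∎
  where
  open ≡-Reasoning
  interchange : ∀ a b x y → a * b * (x * y) ≡ a * x * (b * y)
  interchange = solve-∀

m^[1+d]+[1+d]*m^d≤[1+m]^[1+d] : ∀ d m → m ^ suc d + suc d * m ^ d ≤ suc m ^ suc d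
m^[1+d]+[1+d]*m^d≤[1+m]^[1+d] zero m = ≤-reflexive (identity m)
  where
  identity : ∀ m → m * 1 + (1 + 0) ≡ suc m * 1
  identity = solve-∀
m^[1+d]+[1+d]*m^d≤[1+m]^[1+d] (suc d) m = begin
  m * (m * A) + suc (suc d) * (m * A)              ≤⟨ m≤m+n _ (suc d * A) ⟩
  m * (m * A) + suc (suc d) * (m * A) + suc d * A  ≡⟨ identity m A d ⟩
  suc m * (m * A + suc d * A)                      ≤⟨ *-monoʳ-≤ (suc m) (m^[1+d]+[1+d]*m^d≤[1+m]^[1+d] d m) ⟩
  suc m * suc m ^ suc d                            ∎
  where
  open ≤-Reasoning
  A = m ^ d
  identity : ∀ m A d → m * (m * A) + suc (suc d) * (m * A) + suc d * A ≡ suc m * (m * A + suc d * A)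
  identity = solve-∀

[1+m]^[1+d]≤m^[1+d]+[1+d]*[1+m]^d : ∀ d m → suc m ^ suc d ≤ m ^ suc d + suc d * suc m ^ d
[1+m]^[1+d]≤m^[1+d]+[1+d]*[1+m]^d zero m = ≤-reflexive (identity m)
  where
  identity : ∀ m → suc m * 1 ≡ m * 1 + (1 + 0)
  identity = solve-∀
[1+m]^[1+d]≤m^[1+d]+[1+d]*[1+m]^d (suc d) m = begin
  suc m * suc m ^ suc d                                ≤⟨ *-monoʳ-≤ (suc m) ([1+m]^[1+d]≤m^[1+d]+[1+d]*[1+m]^d d m) ⟩
  suc m * (m ^ suc d + suc d * suc m ^ d)              ≡⟨ identity m (m ^ suc d) (suc m ^ d) d ⟩
  m * m ^ suc d + (m ^ suc d + suc d * suc m ^ suc d)  ≤⟨ +-monoʳ-≤ (m * m ^ suc d) (+-monoˡ-≤ _ (^-monoˡ-≤ (suc d) (n≤1+n m))) ⟩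
  m * m ^ suc d + (suc m ^ suc d + suc d * suc m ^ suc d)  ∎
  where
  open ≤-Reasoning
  identity : ∀ m a b d → suc m * (a + suc d * b) ≡ m * a + (a + suc d * (suc m * b))
  identity = solve-∀

sumRange-pow-upper : ∀ d lo len → suc d * sumRange lo len (λ j → suc j ^ d) + suc lo ^ suc d ≤ suc (lo + len) ^ suc d
sumRange-pow-upper d lo zero = ≤-reflexive (begin
  suc d * 0 + suc lo ^ suc d   ≡⟨ cong (_+ suc lo ^ suc d) (*-zeroʳ (suc d)) ⟩
  suc lo ^ suc d               ≡⟨ cong (λ k → suc k ^ suc d) (+-identityʳ lo) ⟨
  suc (lo + 0) ^ suc d         ∎)
  where open ≡-Reasoning
sumRange-pow-upper d lo (suc len) = begin
  suc d * (suc lo ^ d + S) + suc lo ^ suc d        ≡⟨ identity (suc d) (suc lo ^ d) S (suc lo ^ suc d) ⟩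
  suc d * S + (suc lo ^ suc d + suc d * suc lo ^ d) ≤⟨ +-monoʳ-≤ (suc d * S) (m^[1+d]+[1+d]*m^d≤[1+m]^[1+d] d (suc lo)) ⟩
  suc d * S + suc (suc lo) ^ suc d                  ≤⟨ sumRange-pow-upper d (suc lo) len ⟩
  suc (suc lo + len) ^ suc d                        ≡⟨ cong (λ k → suc k ^ suc d) (+-suc lo len) ⟨
  suc (lo + suc len) ^ suc d                        ∎
  where
  open ≤-Reasoning
  S = sumRange (suc lo) len (λ j → suc j ^ d)
  identity : ∀ a x y z → a * (x + y) + z ≡ a * y + (z + a * x)
  identity = solve-∀

sumRange-pow-lower : ∀ d lo len → (lo + len) ^ suc d ≤ lo ^ suc d + suc d * sumRange (suc lo) len (λ j → j ^ d)
sumRange-pow-lower d lo zero = ≤-reflexive (begin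
  (lo + 0) ^ suc d             ≡⟨ cong (_^ suc d) (+-identityʳ lo) ⟩
  lo ^ suc d                   ≡⟨ +-identityʳ _ ⟨
  lo ^ suc d + 0               ≡⟨ cong (lo ^ suc d +_) (*-zeroʳ (suc d)) ⟨
  lo ^ suc d + suc d * 0       ∎)
  where open ≡-Reasoning
sumRange-pow-lower d lo (suc len) = begin
  (lo + suc len) ^ suc d                          ≡⟨ cong (_^ suc d) (+-suc lo len) ⟩
  (suc lo + len) ^ suc d                          ≤⟨ sumRange-pow-lower d (suc lo) len ⟩
  suc lo ^ suc d + suc d * S                      ≤⟨ +-monoˡ-≤ (suc d * S) ([1+m]^[1+d]≤m^[1+d]+[1+d]*[1+m]^d d lo) ⟩
  lo ^ suc d + suc d * suc lo ^ d + suc d * S     ≡⟨ identity (lo ^ suc d) (suc d) (suc lo ^ d) S ⟩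
  lo ^ suc d + suc d * (suc lo ^ d + S)           ∎
  where
  open ≤-Reasoning
  S = sumRange (suc (suc lo)) len (λ j → j ^ d)
  identity : ∀ z a x y → z + a * x + a * y ≡ z + a * (x + y)
  identity = solve-∀

chainCount-upper : ∀ d k → d ! * chainCount d k ≤ 2 ^ (suc d C 2) * suc k ^ d
chainCount-upper zero    k = ≤-refl
chainCount-upper (suc d) k = begin
  suc d * d ! * sumRange (suc k) k (chainCount d)            ≡⟨ *-assoc (suc d) (d !) _ ⟩
  suc d * (d ! * sumRange (suc k) k (chainCount d))          ≡⟨ cong (suc d *_) (sumRange-*ˡ (d !) (suc k) k (chainCount d)) ⟨
  suc d * sumRange (suc k) k (λ j → d ! * chainCount d j)    ≤⟨ *-monoʳ-≤ (suc d) (sumRange-mono-≤ (suc k) k (λ j _ → chainCount-upper d j)) ⟩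
  suc d * sumRange (suc k) k (λ j → E * suc j ^ d)           ≡⟨ cong (suc d *_) (sumRange-*ˡ E (suc k) k (λ j → suc j ^ d)) ⟩
  suc d * (E * S)                                            ≡⟨ swap (suc d) E S ⟩
  E * (suc d * S)                                            ≤⟨ *-monoʳ-≤ E (≤-trans (m≤m+n _ _) (sumRange-pow-upper d (suc k) k)) ⟩
  E * suc (suc k + k) ^ suc d                                ≡⟨ cong (λ m → E * m ^ suc d) (double k) ⟩
  E * (2 * suc k) ^ suc d                                    ≡⟨ cong (E *_) (^-distrib-* 2 (suc k) (suc d)) ⟩
  E * (2 ^ suc d * suc k ^ suc d)                            ≡⟨ *-assoc E _ _ ⟨
  E * 2 ^ suc d * suc k ^ suc d                              ≡⟨ cong (_* suc k ^ suc d) (2^[[2+n]C2]≡2^[[1+n]C2]*2^[1+n] d) ⟨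
  2 ^ (suc (suc d) C 2) * suc k ^ suc d                      ∎
  where
  open ≤-Reasoning
  E = 2 ^ (suc d C 2)
  S = sumRange (suc k) k (λ j → suc j ^ d)
  swap : ∀ a b c → a * (b * c) ≡ b * (a * c)
  swap = solve-∀
  double : ∀ k → suc (suc k + k) ≡ 2 * suc k
  double = solve-∀

chainCount-upper-delayed : ∀ i d k →
  d ! * chainCount (i + d) k ≤ k ^ i * 2 ^ (i C 2) * (2 ^ (suc d C 2) * suc (2 ^ i * k) ^ d)
chainCount-upper-delayed zero d k = begin
  d ! * chainCount d k                                 ≤⟨ chainCount-upper d k ⟩
  2 ^ (suc d C 2) * suc k ^ d                          ≡⟨ cong (λ m → 2 ^ (suc d C 2) * suc m ^ d) (*-identityˡ k) ⟨
  2 ^ (suc d C 2) * suc (1 * k) ^ d                    ≡⟨ +-identityʳ _ ⟨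
  1 * 1 * (2 ^ (suc d C 2) * suc (1 * k) ^ d)          ∎
  where open ≤-Reasoning
chainCount-upper-delayed (suc i) d k = begin
  d ! * sumRange (suc k) k (chainCount (i + d))             ≡⟨ sumRange-*ˡ (d !) (suc k) k _ ⟨
  sumRange (suc k) k (λ j → d ! * chainCount (i + d) j)     ≤⟨ sumRange-≤-* (suc k) k (bound (2 * k)) bound-2k ⟩
  k * bound (2 * k)                                         ≡⟨ cong (λ m → k * ((2 * k) ^ i * 2 ^ (i C 2) * (E * suc m ^ d))) (reassoc (2 ^ i) k) ⟩
  k * ((2 * k) ^ i * 2 ^ (i C 2) * (E * Z))                 ≡⟨ cong (λ m → k * (m * 2 ^ (i C 2) * (E * Z))) (^-distrib-* 2 k i) ⟩
  k * (2 ^ i * k ^ i * 2 ^ (i C 2) * (E * Z))               ≡⟨ regroup k (2 ^ i) (k ^ i) (2 ^ (i C 2)) (E * Z) ⟩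
  k * k ^ i * (2 ^ (i C 2) * 2 ^ i) * (E * Z)               ≡⟨ cong (λ m → k * k ^ i * m * (E * Z)) (^-distribˡ-+-* 2 (i C 2) i) ⟨
  k * k ^ i * 2 ^ (i C 2 + i) * (E * Z)                     ≡⟨ cong (λ m → k * k ^ i * 2 ^ m * (E * Z)) ([1+n]C2≡nC2+n i) ⟨
  k * k ^ i * 2 ^ (suc i C 2) * (E * Z)                     ∎
  where
  open ≤-Reasoning
  E = 2 ^ (suc d C 2)
  Z = suc (2 * 2 ^ i * k) ^ d
  bound : ℕ → ℕ
  bound j = j ^ i * 2 ^ (i C 2) * (E * suc (2 ^ i * j) ^ d)
  bound-2k : ∀ j → InRange (suc k) k j → d ! * chainCount (i + d) j ≤ bound (2 * k)
  bound-2k j (_ , j<1+k+k) = ≤-trans (chainCount-upper-delayed i d j)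
    (*-mono-≤ (*-monoˡ-≤ (2 ^ (i C 2)) (^-monoˡ-≤ i j≤2k))
              (*-monoʳ-≤ E (^-monoˡ-≤ d (s≤s (*-monoʳ-≤ (2 ^ i) j≤2k)))))
    where
    j≤2k : j ≤ 2 * k
    j≤2k = subst (j ≤_) (sym (2*m≡m+m k)) (s≤s⁻¹ j<1+k+k)
  reassoc : ∀ a k → a * (2 * k) ≡ 2 * a * k
  reassoc = solve-∀
  regroup : ∀ k a b c z → k * (a * b * c * z) ≡ k * b * (c * a) * z
  regroup = solve-∀

[1+y+r]^r*y≤[y+r]^[1+r] : ∀ r y → suc (y + r) ^ r * y ≤ (y + r) ^ suc r
[1+y+r]^r*y≤[y+r]^[1+r] zero y = ≤-reflexive (identity y)
  where
  identity : ∀ y → 1 * y ≡ (y + 0) * 1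
  identity = solve-∀
[1+y+r]^r*y≤[y+r]^[1+r] (suc r) y rewrite +-suc y r = begin
  suc a * suc a ^ r * y     ≡⟨ reorder (suc a) (suc a ^ r) y ⟩
  suc a ^ r * (suc a * y)   ≤⟨ *-monoʳ-≤ (suc a ^ r) (+-mono-≤ y≤a (≤-reflexive (*-comm a y))) ⟩
  suc a ^ r * (suc y * a)   ≡⟨ *-assoc (suc a ^ r) (suc y) a ⟨
  suc a ^ r * suc y * a     ≤⟨ *-monoˡ-≤ a ([1+y+r]^r*y≤[y+r]^[1+r] r (suc y)) ⟩
  a ^ suc r * a             ≡⟨ *-comm (a ^ suc r) a ⟩
  a * a ^ suc r             ∎
  where
  open ≤-Reasoning
  a = suc (y + r)
  y≤a : y ≤ a
  y≤a = ≤-trans (m≤m+n y r) (n≤1+n (y + r))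
  reorder : ∀ x p y → x * p * y ≡ p * (x * y)
  reorder = solve-∀

[1+m]^d≤m^[1+d] : ∀ d m → d < m → suc m ^ d ≤ m ^ suc d
[1+m]^d≤m^[1+d] d m d<m = begin
  suc m ^ d            ≡⟨ *-identityʳ _ ⟨
  suc m ^ d * 1        ≤⟨ *-monoʳ-≤ (suc m ^ d) (m<n⇒0<n∸m d<m) ⟩
  suc m ^ d * y        ≡⟨ cong (λ k → suc k ^ d * y) y+d≡m ⟨
  suc (y + d) ^ d * y  ≤⟨ [1+y+r]^r*y≤[y+r]^[1+r] d y ⟩
  (y + d) ^ suc d      ≡⟨ cong (_^ suc d) y+d≡m ⟩
  m ^ suc d            ∎
  where
  open ≤-Reasoning
  y = m ∸ d
  y+d≡m : y + d ≡ m
  y+d≡m = m∸n+n≡m (<⇒≤ d<m)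

[t+d]!≤d!*[t+d]^t : ∀ t d → (t + d) ! ≤ d ! * (t + d) ^ t
[t+d]!≤d!*[t+d]^t zero    d = ≤-reflexive (sym (*-identityʳ (d !)))
[t+d]!≤d!*[t+d]^t (suc t) d = begin
  suc (t + d) * (t + d) !                 ≤⟨ *-monoʳ-≤ (suc (t + d)) ([t+d]!≤d!*[t+d]^t t d) ⟩
  suc (t + d) * (d ! * (t + d) ^ t)       ≤⟨ *-monoʳ-≤ (suc (t + d)) (*-monoʳ-≤ (d !) (^-monoˡ-≤ t (n≤1+n (t + d)))) ⟩
  suc (t + d) * (d ! * suc (t + d) ^ t)   ≡⟨ swap (suc (t + d)) (d !) (suc (t + d) ^ t) ⟩
  d ! * (suc (t + d) * suc (t + d) ^ t)   ∎
  where
  open ≤-Reasoning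
  swap : ∀ a b c → a * (b * c) ≡ b * (a * c)
  swap = solve-∀

d!*chainCount[i+d]≤2^[[1+i+d]C2] : ∀ i d → suc d ≤ 2 ^ i → d ! * chainCount (i + d) 1 ≤ 2 ^ (suc (i + d) C 2)
d!*chainCount[i+d]≤2^[[1+i+d]C2] i d 1+d≤2^i = begin
  d ! * chainCount (i + d) 1                                    ≤⟨ chainCount-upper-delayed i d 1 ⟩
  1 ^ i * 2 ^ (i C 2) * (2 ^ (suc d C 2) * suc (X * 1) ^ d)     ≡⟨ cong₂ (λ a b → a * 2 ^ (i C 2) * (2 ^ (suc d C 2) * suc b ^ d)) (^-zeroˡ i) (*-identityʳ X) ⟩
  1 * 2 ^ (i C 2) * (2 ^ (suc d C 2) * suc X ^ d)               ≤⟨ *-monoʳ-≤ (1 * 2 ^ (i C 2)) (*-monoʳ-≤ (2 ^ (suc d C 2)) ([1+m]^d≤m^[1+d] d X 1+d≤2^i)) ⟩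
  1 * 2 ^ (i C 2) * (2 ^ (suc d C 2) * X ^ suc d)               ≡⟨ cong (λ m → 1 * 2 ^ (i C 2) * (2 ^ (suc d C 2) * m)) (^-*-assoc 2 i (suc d)) ⟩
  1 * 2 ^ (i C 2) * (2 ^ (suc d C 2) * 2 ^ (i * suc d))         ≡⟨ cong₂ _*_ (*-identityˡ (2 ^ (i C 2))) (sym (^-distribˡ-+-* 2 (suc d C 2) (i * suc d))) ⟩
  2 ^ (i C 2) * 2 ^ (suc d C 2 + i * suc d)                     ≡⟨ ^-distribˡ-+-* 2 (i C 2) _ ⟨
  2 ^ (i C 2 + (suc d C 2 + i * suc d))                         ≡⟨ cong (2 ^_) (+-assoc (i C 2) _ _) ⟨
  2 ^ (i C 2 + suc d C 2 + i * suc d)                           ≡⟨ cong (2 ^_) ([m+n]C2≡mC2+nC2+m*n i (suc d)) ⟨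
  2 ^ ((i + suc d) C 2)                                         ≡⟨ cong (λ m → 2 ^ (m C 2)) (+-suc i d) ⟩
  2 ^ (suc (i + d) C 2)                                         ∎
  where
  open ≤-Reasoning
  X = 2 ^ i

chainCount*!-upper : ∀ i r → i ≤ r → suc r ≤ 2 ^ i → chainCount r 1 * suc r ! ≤ 2 ^ (suc r C 2) * suc r ^ suc i
chainCount*!-upper i r i≤r n≤2^i with d , refl ← m≤n⇒∃[o]m+o≡n i≤r = begin
  chainCount (i + d) 1 * (suc i + d) !    ≤⟨ *-monoʳ-≤ (chainCount (i + d) 1) ([t+d]!≤d!*[t+d]^t (suc i) d) ⟩
  chainCount (i + d) 1 * (d ! * n ^ suc i) ≡⟨ swap (chainCount (i + d) 1) (d !) (n ^ suc i) ⟩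
  d ! * chainCount (i + d) 1 * n ^ suc i   ≤⟨ *-monoˡ-≤ (n ^ suc i) (d!*chainCount[i+d]≤2^[[1+i+d]C2] i d 1+d≤2^i) ⟩
  2 ^ (n C 2) * n ^ suc i                  ∎
  where
  open ≤-Reasoning
  n = suc (i + d)
  1+d≤2^i : suc d ≤ 2 ^ i
  1+d≤2^i = ≤-trans (s≤s (m≤n+m d i)) n≤2^i
  swap : ∀ a b c → a * (b * c) ≡ b * a * c
  swap = solve-∀

mersenne : ℕ → ℕ
mersenne zero    = 1
mersenne (suc d) = suc (2 * mersenne d)

1+mersenne≡2^[1+d] : ∀ d → suc (mersenne d) ≡ 2 ^ suc d
1+mersenne≡2^[1+d] zero    = refl
1+mersenne≡2^[1+d] (suc d) = trans (double (mersenne d)) (cong (2 *_) (1+mersenne≡2^[1+d] d))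
  where
  double : ∀ m → suc (suc (2 * m)) ≡ 2 * suc m
  double = solve-∀

mersenneProduct : ℕ → ℕ
mersenneProduct zero    = 1
mersenneProduct (suc d) = mersenneProduct d * mersenne d

chainCount-lower : ∀ d k → mersenneProduct d * k ^ d ≤ d ! * chainCount d k
chainCount-lower zero    k = ≤-refl
chainCount-lower (suc d) k = +-cancelˡ-≤ (P * k ^ suc d) _ _ (begin
  P * k ^ suc d + P * mersenne d * k ^ suc d      ≡⟨ factor P (mersenne d) (k ^ suc d) ⟩
  P * (suc (mersenne d) * k ^ suc d)              ≡⟨ cong (λ m → P * (m * k ^ suc d)) (1+mersenne≡2^[1+d] d) ⟩
  P * (2 ^ suc d * k ^ suc d)                     ≡⟨ cong (P *_) (^-distrib-* 2 k (suc d)) ⟨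
  P * (2 * k) ^ suc d                             ≡⟨ cong (λ m → P * m ^ suc d) (2*m≡m+m k) ⟩
  P * (k + k) ^ suc d                             ≤⟨ *-monoʳ-≤ P (sumRange-pow-lower d k k) ⟩
  P * (k ^ suc d + suc d * S)                     ≡⟨ distribute P (k ^ suc d) (suc d) S ⟩
  P * k ^ suc d + suc d * (P * S)                 ≡⟨ cong (λ m → P * k ^ suc d + suc d * m) (sumRange-*ˡ P (suc k) k (_^ d)) ⟨
  P * k ^ suc d + suc d * sumRange (suc k) k (λ j → P * j ^ d)
    ≤⟨ +-monoʳ-≤ (P * k ^ suc d) (*-monoʳ-≤ (suc d) (sumRange-mono-≤ (suc k) k (λ j _ → chainCount-lower d j))) ⟩
  P * k ^ suc d + suc d * sumRange (suc k) k (λ j → d ! * chainCount d j)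
    ≡⟨ cong (λ m → P * k ^ suc d + suc d * m) (sumRange-*ˡ (d !) (suc k) k (chainCount d)) ⟩
  P * k ^ suc d + suc d * (d ! * sumRange (suc k) k (chainCount d))
    ≡⟨ cong (P * k ^ suc d +_) (*-assoc (suc d) (d !) _) ⟨
  P * k ^ suc d + suc d * d ! * sumRange (suc k) k (chainCount d) ∎)
  where
  open ≤-Reasoning
  P = mersenneProduct d
  S = sumRange (suc k) k (_^ d)
  factor : ∀ p q x → p * x + p * q * x ≡ p * (suc q * x)
  factor = solve-∀
  distribute : ∀ p a b s → p * (a + b * s) ≡ p * a + b * (p * s)
  distribute = solve-∀

-- In real terms: ∏_{j=1}^{d+1} (1 − 2^{−j}) ≥ 1/4 + 2^{−(d+2)}; the extra 2^{−(d+2)} is what lets the induction go through.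
mersenneProduct-invariant : ∀ d →
  2 ^ (suc (suc d) C 2) * (suc (mersenne d) + 2) ≤ 4 * mersenneProduct (suc d) * suc (mersenne d)
mersenneProduct-invariant zero    = ≤-refl
mersenneProduct-invariant (suc d) = begin
  2 ^ (suc (suc (suc d)) C 2) * (suc M + 2)   ≡⟨ cong (_* (suc M + 2)) 2^[[3+d]C2]≡E*[1+M] ⟩
  E * suc M * (suc M + 2)                     ≤⟨ step E (mersenneProduct (suc d)) (mersenne d) (mersenne-positive d) (mersenneProduct-invariant d) ⟩
  4 * mersenneProduct (suc (suc d)) * suc M   ∎
  where
  open ≤-Reasoning
  E = 2 ^ (suc (suc d) C 2)
  M = mersenne (suc d)
  2^[[3+d]C2]≡E*[1+M] : 2 ^ (suc (suc (suc d)) C 2) ≡ E * suc M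
  2^[[3+d]C2]≡E*[1+M] = trans (2^[[2+n]C2]≡2^[[1+n]C2]*2^[1+n] (suc d)) (cong (E *_) (sym (1+mersenne≡2^[1+d] (suc d))))
  mersenne-positive : ∀ d → 1 ≤ mersenne d
  mersenne-positive zero    = ≤-refl
  mersenne-positive (suc d) = s≤s z≤n
  step : ∀ e p Q → 1 ≤ Q → e * (suc Q + 2) ≤ 4 * p * suc Q →
         e * suc (suc (2 * Q)) * (suc (suc (2 * Q)) + 2) ≤ 4 * (p * suc (2 * Q)) * suc (suc (2 * Q))
  step e p (suc w) _ h = begin
    e * suc (suc (2 * suc w)) * (suc (suc (2 * suc w)) + 2)               ≤⟨ m≤m+n _ (2 * e * w) ⟩
    e * suc (suc (2 * suc w)) * (suc (suc (2 * suc w)) + 2) + 2 * e * w   ≡⟨ expand e w ⟩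
    2 * (e * (suc (suc w) + 2)) * suc (2 * suc w)                         ≤⟨ *-monoˡ-≤ (suc (2 * suc w)) (*-monoʳ-≤ 2 h) ⟩
    2 * (4 * p * suc (suc w)) * suc (2 * suc w)                           ≡⟨ regroup p w ⟩
    4 * (p * suc (2 * suc w)) * suc (suc (2 * suc w))                     ∎
    where
    expand : ∀ e w → e * suc (suc (2 * suc w)) * (suc (suc (2 * suc w)) + 2) + 2 * e * w
                   ≡ 2 * (e * (suc (suc w) + 2)) * suc (2 * suc w)
    expand = solve-∀
    regroup : ∀ p w → 2 * (4 * p * suc (suc w)) * suc (2 * suc w) ≡ 4 * (p * suc (2 * suc w)) * suc (suc (2 * suc w))
    regroup = solve-∀

2^[[1+d]C2]≤4*mersenneProduct : ∀ d → 2 ^ (suc d C 2) ≤ 4 * mersenneProduct d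
2^[[1+d]C2]≤4*mersenneProduct zero    = s≤s z≤n
2^[[1+d]C2]≤4*mersenneProduct (suc d) = *-cancelʳ-≤ _ _ (suc (mersenne d))
  (≤-trans (*-monoʳ-≤ (2 ^ (suc (suc d) C 2)) (m≤m+n (suc (mersenne d)) 2)) (mersenneProduct-invariant d))

chainCount*!-lower : ∀ r → 2 ^ (suc r C 2) ≤ 4 * (chainCount r 1 * suc r !)
chainCount*!-lower r = begin
  2 ^ (suc r C 2)                       ≤⟨ 2^[[1+d]C2]≤4*mersenneProduct r ⟩
  4 * mersenneProduct r                 ≡⟨ cong (4 *_) (trans (cong (mersenneProduct r *_) (^-zeroˡ r)) (*-identityʳ (mersenneProduct r))) ⟨
  4 * (mersenneProduct r * 1 ^ r)       ≤⟨ *-monoʳ-≤ 4 (chainCount-lower r 1) ⟩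
  4 * (r ! * chainCount r 1)            ≤⟨ *-monoʳ-≤ 4 (*-monoˡ-≤ (chainCount r 1) (m≤n*m (r !) (suc r))) ⟩
  4 * (suc r ! * chainCount r 1)        ≡⟨ cong (4 *_) (*-comm (suc r !) (chainCount r 1)) ⟩
  4 * (chainCount r 1 * suc r !)        ∎
  where open ≤-Reasoning

n<2^[1+⌊log₂n⌋] : ∀ n → n < 2 ^ suc ⌊log₂ n ⌋
n<2^[1+⌊log₂n⌋] n = ≰⇒> λ 2^[1+L]≤n →
  n≮n ⌊log₂ n ⌋ (subst (_≤ ⌊log₂ n ⌋) (⌊log₂[2^n]⌋≡n (suc ⌊log₂ n ⌋)) (⌊log₂⌋-mono-≤ 2^[1+L]≤n))

1≤⌊log₂n⌋ : ∀ {n} → 2 ≤ n → 1 ≤ ⌊log₂ n ⌋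
1≤⌊log₂n⌋ {n} 2≤n = subst (_≤ ⌊log₂ n ⌋) (⌊log₂[2^n]⌋≡n 1) (⌊log₂⌋-mono-≤ 2≤n)

2+n≤2^n : ∀ n → 2 ≤ n → 2 + n ≤ 2 ^ n
2+n≤2^n 2                     _ = ≤-refl
2+n≤2^n 1                     (s≤s ())
2+n≤2^n (suc n@(suc (suc _))) _ =
  ≤-trans (s≤s (2+n≤2^n n (s≤s (s≤s z≤n))))
          (≤-trans (m<m*n (2 ^ n) 2 {{m^n≢0 2 n}} ≤-refl) (≤-reflexive (*-comm (2 ^ n) 2)))

2+⌊log₂n⌋≤n : ∀ {n} → 4 ≤ n → 2 + ⌊log₂ n ⌋ ≤ n
2+⌊log₂n⌋≤n {n} 4≤n = subst (2 + ⌊log₂ n ⌋ ≤_) 2+m≡n (+-monoʳ-≤ 2 ⌊log₂n⌋≤m)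
  where
  m = n ∸ 2
  2+m≡n : 2 + m ≡ n
  2+m≡n = m+[n∸m]≡n (≤-trans (s≤s (s≤s z≤n)) 4≤n)
  ⌊log₂n⌋≤m : ⌊log₂ n ⌋ ≤ m
  ⌊log₂n⌋≤m = subst (⌊log₂ n ⌋ ≤_) (⌊log₂[2^n]⌋≡n m)
    (⌊log₂⌋-mono-≤ (subst (_≤ 2 ^ m) 2+m≡n (2+n≤2^n m (∸-monoˡ-≤ 2 4≤n))))

[1+L]*[2+L]≤6*L*L : ∀ L → 1 ≤ L → suc L * suc (suc L) ≤ 6 * L * L
[1+L]*[2+L]≤6*L*L (suc l) _ = ≤-trans (m≤m+n _ (5 * l * l + 7 * l)) (≤-reflexive (expand l))
  where
  expand : ∀ l → suc (suc l) * suc (suc (suc l)) + (5 * l * l + 7 * l) ≡ 6 * suc l * suc l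
  expand = solve-∀

chainCount*!-upper-log : ∀ r → 3 ≤ r →
  chainCount r 1 * suc r ! ≤ 2 ^ (suc r C 2 + 6 * ⌊log₂ suc r ⌋ * ⌊log₂ suc r ⌋)
chainCount*!-upper-log r 3≤r = begin
  chainCount r 1 * n !           ≤⟨ chainCount*!-upper (suc L) r 1+L≤r n≤2^[1+L] ⟩
  2 ^ (n C 2) * n ^ suc (suc L)  ≤⟨ *-monoʳ-≤ (2 ^ (n C 2)) n^[2+L]≤2^[6*L*L] ⟩
  2 ^ (n C 2) * 2 ^ (6 * L * L)  ≡⟨ ^-distribˡ-+-* 2 (n C 2) (6 * L * L) ⟨
  2 ^ (n C 2 + 6 * L * L)        ∎
  where
  open ≤-Reasoning
  n = suc r
  L = ⌊log₂ n ⌋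
  1+L≤r : suc L ≤ r
  1+L≤r = s≤s⁻¹ (2+⌊log₂n⌋≤n (s≤s 3≤r))
  n≤2^[1+L] : n ≤ 2 ^ suc L
  n≤2^[1+L] = <⇒≤ (n<2^[1+⌊log₂n⌋] n)
  n^[2+L]≤2^[6*L*L] : n ^ suc (suc L) ≤ 2 ^ (6 * L * L)
  n^[2+L]≤2^[6*L*L] = begin
    n ^ suc (suc L)                ≤⟨ ^-monoˡ-≤ (suc (suc L)) n≤2^[1+L] ⟩
    (2 ^ suc L) ^ suc (suc L)      ≡⟨ ^-*-assoc 2 (suc L) (suc (suc L)) ⟩
    2 ^ (suc L * suc (suc L))      ≤⟨ ^-monoʳ-≤ 2 ([1+L]*[2+L]≤6*L*L L (1≤⌊log₂n⌋ {n} (s≤s (≤-trans (s≤s z≤n) 3≤r)))) ⟩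
    2 ^ (6 * L * L)                ∎

chainCount*!-lower-log : ∀ r → 1 ≤ r →
  2 ^ (suc r C 2) ≤ chainCount r 1 * suc r ! * 2 ^ (6 * ⌊log₂ suc r ⌋ * ⌊log₂ suc r ⌋)
chainCount*!-lower-log r 1≤r = begin
  2 ^ (suc r C 2)                  ≤⟨ chainCount*!-lower r ⟩
  4 * (c * suc r !)                ≡⟨ *-comm 4 (c * suc r !) ⟩
  c * suc r ! * 4                  ≤⟨ *-monoʳ-≤ (c * suc r !) (^-monoʳ-≤ 2 2≤6*L*L) ⟩
  c * suc r ! * 2 ^ (6 * L * L)    ∎
  where
  open ≤-Reasoning
  c = chainCount r 1
  L = ⌊log₂ suc r ⌋
  1≤L : 1 ≤ L
  1≤L = 1≤⌊log₂n⌋ (s≤s 1≤r)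
  2≤6*L*L : 2 ≤ 6 * L * L
  2≤6*L*L = ≤-trans (m≤m+n 2 4) (*-mono-≤ (*-monoʳ-≤ 6 1≤L) 1≤L)

theorem3 : (s : ℕ → ℕ) → (∀ n → Fin (s n) ↔ TournamentSeq n) →
    ∃[ K ] ∃[ N ] (∀ n → N ≤ n →
      (s n * n ! ≤ 2 ^ (n C 2 + K * ⌊log₂ n ⌋ * ⌊log₂ n ⌋))
      × (2 ^ (n C 2) ≤ s n * n ! * 2 ^ (K * ⌊log₂ n ⌋ * ⌊log₂ n ⌋)))
theorem3 s s↔TournamentSeq = 6 , 4 , bounds
  where
  bounds : ∀ n → 4 ≤ n →
    (s n * n ! ≤ 2 ^ (n C 2 + 6 * ⌊log₂ n ⌋ * ⌊log₂ n ⌋))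
    × (2 ^ (n C 2) ≤ s n * n ! * 2 ^ (6 * ⌊log₂ n ⌋ * ⌊log₂ n ⌋))
  bounds (suc r) (s≤s 3≤r) rewrite tournamentCount s s↔TournamentSeq r =
    chainCount*!-upper-log r 3≤r , chainCount*!-lower-log r (≤-trans (s≤s z≤n) 3≤r)
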